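{- Let $m,n>1$ be integers such that $p=\gcd(m,n)$ is an odd prime and $\gcd(pm,n)=\gcd(m,pn)=p$. Then $\tau(T_{m\times n})=\tau(T_{p\times p})$.
   Context: For integers $m,n>1$, the discrete torus is $T_{m\times n}=\{0,\dots,m-1\}\times\{0,\dots,n-1\}$, with projection $\pi_{m,n}:\mathbb Z\times\mathbb Z\to T_{m\times n}$, $\pi_{m,n}(a,b)=(a \bmod m,\ b\bmod n)$ (least non-negative remainders). A line in $\mathbb Z\times\mathbb Z$ is a set $\{(a+uk,b+vk):k\in\mathbb Z\}$ with $a,b,u,v\in\mathbb Z$ and $\gcd(u,v)=1$. A line on $T_{m\times n}$ is the image under $\pi_{m,n}$ of a line in $\mathbb Z\times\mathbb Z$. Three points are collinear if some line contains all three; a set satisfies the no-three-in-line condition if no three of its distinct points are collinear, and $\tau(T_{m\times n})$ is the maximum size of such a subset of $T_{m\times n}$. -}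

module Defs where

open import Data.Nat as ℕ using (ℕ; _<_; _≤_)
open import Data.Fin using (Fin; toℕ)
open import Data.Integer as ℤ using (ℤ; +_; _+_; _*_; _-_)
open import Data.Integer.Divisibility using (_∣_)
open import Data.Integer.GCD using (gcd)
open import Data.Product using (_×_; _,_; Σ; ∃)
open import Data.List using (List; length)
open import Data.List.Membership.Propositional using (_∈_)
open import Data.List.Relation.Unary.Unique.Propositional using (Unique)
open import Relation.Binary.PropositionalEquality using (_≡_; _≢_)
open import Relation.Nullary using (¬_)

Torus : ℕ → ℕ → Set
Torus m n = Fin m × Fin n

-- π_{m,n}(a,b) = (x,y), i.e. x = a mod m and y = b mod n (least non-negative
-- remainders).  Since x < m, "x = a mod m" is equivalent to m ∣ a - x.
ProjEq : (m n : ℕ) → ℤ → ℤ → Torus m n → Set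
ProjEq m n a b (x , y) = ((+ m) ∣ (a - + toℕ x)) × ((+ n) ∣ (b - + toℕ y))

-- The line {(a+uk, b+vk) : k ∈ ℤ} in ℤ×ℤ (with gcd(u,v)=1) is encoded by (a,b,u,v);
-- a point P of the torus lies on its image under π_{m,n} iff some k maps to P.
OnLine : (m n : ℕ) → ℤ → ℤ → ℤ → ℤ → Torus m n → Set
OnLine m n a b u v P = ∃ λ (k : ℤ) → ProjEq m n (a + u * k) (b + v * k) P

Collinear : (m n : ℕ) → Torus m n → Torus m n → Torus m n → Set
Collinear m n P Q R =
  Σ ℤ λ a → Σ ℤ λ b → Σ ℤ λ u → Σ ℤ λ v →
    (gcd u v ≡ + 1) × OnLine m n a b u v P × OnLine m n a b u v Q × OnLine m n a b u v R

NoThreeInLine : (m n : ℕ) → List (Torus m n) → Set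
NoThreeInLine m n S =
  ∀ P Q R → P ∈ S → Q ∈ S → R ∈ S → P ≢ Q → Q ≢ R → P ≢ R → ¬ Collinear m n P Q R

IsTau : (m n : ℕ) → ℕ → Set
IsTau m n t =
  (∃ λ (S : List (Torus m n)) → Unique S × NoThreeInLine m n S × length S ≡ t)
  × (∀ (S : List (Torus m n)) → Unique S → NoThreeInLine m n S → length S ≤ t)

module Submission where

-- Write m = p m₁ and n = p n₁, so that the hypotheses say gcd(m, n₁) = gcd(n, m₁) = 1.  Every line of
-- T_{p×p} lifts to a line of T_{m×n} through all points of T_{m×n} that reduce onto it: if the direction
-- (u, v) has u invertible modulo p, the Chinese remainder theorem gives a slope w ≡ v u⁻¹ (mod p),
-- w ≡ 1 (mod n₁), and the line of direction (1, w) with the same base point meets each such point at a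
-- parameter that is again found by the Chinese remainder theorem, modulo m and n₁.  The case of v
-- invertible is symmetric, and a direction divisible by p may be replaced by (1, 0).  Hence reduction
-- modulo p is injective on no-three-in-line sets of T_{m×n} with at least three points and maps them to
-- no-three-in-line sets of T_{p×p}; conversely T_{p×p} ⊆ T_{m×n} sends no-three-in-line sets to
-- no-three-in-line sets.  Both tori contain three points in general position, so the maxima agree.

open import Defs
open import Data.Nat as ℕ using (ℕ; suc; NonZero; _≤_; _<_; s≤s; nonTrivial⇒n>1)
import Data.Nat.Properties as ℕ
import Data.Nat.Divisibility as ℕ
open import Data.Nat.DivMod using (_%_; _/_; m≡m%n+[m/n]*n; m%n<n)
open import Data.Nat.GCD using (gcd; module Bézout; c*gcd[m,n]≡gcd[cm,cn]; gcd[m,n]∣m; gcd[m,n]∣n)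
open import Data.Nat.Coprimality as Coprimality using (Coprime; coprime-Bézout; coprime-divisor; gcd≡1⇒coprime)
open import Data.Nat.Primality using (Prime; prime⇒irreducible; prime⇒nonZero; prime⇒nonTrivial)
open import Data.Integer using (ℤ; +_; 0ℤ; 1ℤ; _+_; _*_; _-_; -_; ∣_∣)
open import Data.Integer.Properties
  using (+-identityʳ; *-identityˡ; *-identityʳ; +-inverseʳ; *-comm; pos-*; +∣i∣≡i⊎+∣i∣≡-i)
open import Data.Integer.Divisibility using (_∣_)
import Data.Integer.Divisibility.Signed as Signed
open import Data.Integer.GCD using (gcd-zeroˡ; gcd-zeroʳ)
import Data.Integer.GCD as ℤ
open import Data.Integer.Tactic.RingSolver using (solve-∀)
open import Data.Fin using (Fin; toℕ; fromℕ<; inject≤; zero; suc)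
open import Data.Fin.Properties using (toℕ-fromℕ<; toℕ-inject≤; inject≤-injective) renaming (_≟_ to _≟ᶠ_)
open import Data.Product using (Σ; ∃; _×_; _,_; proj₁; proj₂)
open import Data.Product.Properties using (≡-dec)
open import Data.Sum using (_⊎_; inj₁; inj₂; [_,_])
open import Data.Empty using (⊥-elim)
open import Data.List using (List; []; _∷_; length; map)
open import Data.List.Properties using (length-map)
open import Data.List.Membership.Propositional using (_∈_)
open import Data.List.Membership.Propositional.Properties using (∈-map⁻)
open import Data.List.Relation.Unary.Any using (here; there)
open import Data.List.Relation.Unary.All using ([]; _∷_)
import Data.List.Relation.Unary.All as All
import Data.List.Relation.Unary.All.Properties as All
open import Data.List.Relation.Unary.AllPairs using ([]; _∷_)
open import Data.List.Relation.Unary.Unique.Propositional using (Unique)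
import Data.List.Relation.Unary.Unique.Propositional.Properties as Unique
open import Function.Bundles using (_⇔_; mk⇔)
open import Relation.Binary.Bundles using (Setoid)
open import Relation.Binary.Structures using (IsEquivalence)
open import Relation.Binary.Definitions using (DecidableEquality)
import Relation.Binary.Reasoning.Setoid as SetoidReasoning
open import Relation.Binary.PropositionalEquality using (_≡_; _≢_; refl; sym; trans; cong; cong₂; subst; subst₂)
open import Relation.Nullary using (¬_; yes; no; contradiction)

-- Congruences of integers

-- Congruences (and OnLineℤ below) are records rather than definitions so that Agda can infer the integers
-- involved: integer multiplication unfolds eagerly, which defeats unification through a bare divisibility.
infix 4 _≡_mod_
record _≡_mod_ (a b : ℤ) (N : ℕ) : Set where
  constructor congruent
  field divides-difference : + N ∣ a - b

module _ {N : ℕ} where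

  private
    signed : ∀ {a b} → a ≡ b mod N → + N Signed.∣ a - b
    signed (congruent N∣a-b) = Signed.∣ᵤ⇒∣ N∣a-b

    from-signed : ∀ {a b z} → z ≡ a - b → + N Signed.∣ z → a ≡ b mod N
    from-signed refl N∣z = congruent (Signed.∣⇒∣ᵤ N∣z)

  mod-refl : ∀ {a} → a ≡ a mod N
  mod-refl {a} = from-signed (sym (+-inverseʳ a)) (Signed.divides 0ℤ refl)

  mod-reflexive : ∀ {a b} → a ≡ b → a ≡ b mod N
  mod-reflexive refl = mod-refl

  mod-sym : ∀ {a b} → a ≡ b mod N → b ≡ a mod N
  mod-sym {a} {b} a≡b = from-signed (negate a b) (Signed.∣m⇒∣-m (signed a≡b))
    where
    negate : ∀ a b → - (a - b) ≡ b - a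
    negate = solve-∀

  mod-trans : ∀ {a b c} → a ≡ b mod N → b ≡ c mod N → a ≡ c mod N
  mod-trans {a} {b} {c} a≡b b≡c =
    from-signed (telescope a b c) (Signed.∣m∣n⇒∣m+n (signed a≡b) (signed b≡c))
    where
    telescope : ∀ a b c → (a - b) + (b - c) ≡ a - c
    telescope = solve-∀

  +-cong-mod : ∀ {a b c d} → a ≡ b mod N → c ≡ d mod N → a + c ≡ b + d mod N
  +-cong-mod {a} {b} {c} {d} a≡b c≡d =
    from-signed (interchange a b c d) (Signed.∣m∣n⇒∣m+n (signed a≡b) (signed c≡d))
    where
    interchange : ∀ a b c d → (a - b) + (c - d) ≡ (a + c) - (b + d)
    interchange = solve-∀

  +-congˡ-mod : ∀ a {b c} → b ≡ c mod N → a + b ≡ a + c mod N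
  +-congˡ-mod a = +-cong-mod (mod-refl {a})

  -cong-mod : ∀ {a b c d} → a ≡ b mod N → c ≡ d mod N → a - c ≡ b - d mod N
  -cong-mod {a} {b} {c} {d} a≡b c≡d =
    from-signed (interchange a b c d) (Signed.∣m∣n⇒∣m-n (signed a≡b) (signed c≡d))
    where
    interchange : ∀ a b c d → (a - b) - (c - d) ≡ (a - c) - (b - d)
    interchange = solve-∀

  *-congˡ-mod : ∀ c {a b} → a ≡ b mod N → c * a ≡ c * b mod N
  *-congˡ-mod c {a} {b} a≡b = from-signed (distrib c a b) (Signed.∣n⇒∣m*n c (signed a≡b))
    where
    distrib : ∀ c a b → c * (a - b) ≡ c * a - c * b
    distrib = solve-∀

  *-congʳ-mod : ∀ c {a b} → a ≡ b mod N → a * c ≡ b * c mod N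
  *-congʳ-mod c {a} {b} a≡b = from-signed (distrib c a b) (Signed.∣m⇒∣m*n c (signed a≡b))
    where
    distrib : ∀ c a b → (a - b) * c ≡ a * c - b * c
    distrib = solve-∀

  *-cong-mod : ∀ {a b c d} → a ≡ b mod N → c ≡ d mod N → a * c ≡ b * d mod N
  *-cong-mod {b = b} {c} a≡b c≡d = mod-trans (*-congʳ-mod c a≡b) (*-congˡ-mod b c≡d)

  +-multiple-mod : ∀ a k → a + + N * k ≡ a mod N
  +-multiple-mod a k = from-signed (cancel a (+ N * k)) (Signed.∣m⇒∣m*n k Signed.∣-refl)
    where
    cancel : ∀ a x → x ≡ (a + x) - a
    cancel = solve-∀

  ∣⇒≡0-mod : ∀ {a} → + N ∣ a → a ≡ 0ℤ mod N
  ∣⇒≡0-mod {a} N∣a = congruent (subst (+ N ∣_) (sym (+-identityʳ a)) N∣a)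

  mod-isEquivalence : IsEquivalence (λ a b → a ≡ b mod N)
  mod-isEquivalence = record { refl = mod-refl ; sym = mod-sym ; trans = mod-trans }

mod-setoid : ℕ → Setoid _ _
mod-setoid N = record { isEquivalence = mod-isEquivalence {N} }

module ≡-mod-Reasoning (N : ℕ) = SetoidReasoning (mod-setoid N)

module _ {N : ℕ} where
  open ≡-mod-Reasoning N

  +-moveˡ-mod : ∀ {a x X} → x ≡ X - a mod N → a + x ≡ X mod N
  +-moveˡ-mod {a} {x} {X} x≡X-a = begin
    a + x        ≈⟨ +-congˡ-mod a x≡X-a ⟩
    a + (X - a)  ≡⟨ cancel a X ⟩
    X            ∎
    where
    cancel : ∀ a X → a + (X - a) ≡ X
    cancel = solve-∀

  +-moveʳ-mod : ∀ {a x X} → a + x ≡ X mod N → x ≡ X - a mod N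
  +-moveʳ-mod {a} {x} {X} a+x≡X = begin
    x            ≡⟨ cancel a x ⟩
    a + x - a    ≈⟨ +-cong-mod a+x≡X (mod-refl {a = - a}) ⟩
    X - a        ∎
    where
    cancel : ∀ a x → x ≡ a + x - a
    cancel = solve-∀

%-≡-mod : ∀ a N .{{_ : NonZero N}} → + (a % N) ≡ + a mod N
%-≡-mod a N = begin
  + (a % N)                    ≈⟨ mod-sym (+-multiple-mod (+ (a % N)) (+ (a / N))) ⟩
  + (a % N) + + N * + (a / N)  ≡⟨ cong (λ z → + (a % N) + z) (trans (*-comm (+ N) _) (sym (pos-* (a / N) N))) ⟩
  + (a % N ℕ.+ a / N ℕ.* N)    ≡⟨ cong +_ (sym (m≡m%n+[m/n]*n a N)) ⟩
  + a                          ∎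
  where open ≡-mod-Reasoning N

mod-divisor : ∀ {d N a b} → d ℕ.∣ N → a ≡ b mod N → a ≡ b mod d
mod-divisor d∣N (congruent N∣a-b) = congruent (ℕ.∣-trans d∣N N∣a-b)

coprime-∣⇒*∣ : ∀ {p q k} → Coprime p q → p ℕ.∣ k → q ℕ.∣ k → p ℕ.* q ℕ.∣ k
coprime-∣⇒*∣ {p} {q} p⊥q (ℕ.divides i refl) q∣ip
  with coprime-divisor (Coprimality.sym p⊥q) (subst (q ℕ.∣_) (ℕ.*-comm i p) q∣ip)
... | ℕ.divides j refl = ℕ.divides j (trans (ℕ.*-assoc j q p) (cong (j ℕ.*_) (ℕ.*-comm q p)))

mod-chinese : ∀ {p q a b} → Coprime p q → a ≡ b mod p → a ≡ b mod q → a ≡ b mod p ℕ.* q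
mod-chinese p⊥q (congruent p∣a-b) (congruent q∣a-b) = congruent (coprime-∣⇒*∣ p⊥q p∣a-b q∣a-b)

gcd[cm,cn]≡c⇒coprime : ∀ c m n .{{_ : NonZero c}} → gcd (c ℕ.* m) (c ℕ.* n) ≡ c → Coprime m n
gcd[cm,cn]≡c⇒coprime c m n gcd≡c = gcd≡1⇒coprime (ℕ.*-cancelˡ-≡ (gcd m n) 1 c
  (trans (c*gcd[m,n]≡gcd[cm,cn] c m n) (trans gcd≡c (sym (ℕ.*-identityʳ c)))))

prime∤⇒coprime : ∀ {p n} → Prime p → ¬ (p ℕ.∣ n) → Coprime n p
prime∤⇒coprime p-prime p∤n (d∣n , d∣p) with prime⇒irreducible p-prime d∣p
... | inj₁ d≡1 = d≡1
... | inj₂ refl = contradiction d∣n p∤n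

private
  pos-1+* : ∀ x a {z} → 1 ℕ.+ x ℕ.* a ≡ z → 1ℤ + + x * + a ≡ + z
  pos-1+* x a eq = trans (cong (λ z → 1ℤ + z) (sym (pos-* x a))) (cong +_ eq)

coprime⇒invertible : ∀ {a N} → Coprime a N → ∃ λ α → α * + a ≡ 1ℤ mod N
coprime⇒invertible {a} {N} a⊥N with coprime-Bézout a⊥N
... | Bézout.+- x y eq = + x , (begin
  + x * + a       ≡⟨ sym (pos-* x a) ⟩
  + (x ℕ.* a)     ≡⟨ sym (pos-1+* y N eq) ⟩
  1ℤ + + y * + N  ≡⟨ cong (λ z → 1ℤ + z) (*-comm (+ y) (+ N)) ⟩
  1ℤ + + N * + y  ≈⟨ +-multiple-mod 1ℤ (+ y) ⟩
  1ℤ              ∎)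
  where open ≡-mod-Reasoning N
... | Bézout.-+ x y eq = - + x , (begin
  (- + x) * + a          ≡⟨ negate (+ x) (+ a) ⟩
  1ℤ - (1ℤ + + x * + a)  ≡⟨ cong (λ z → 1ℤ - z) (trans (pos-1+* x a eq) (pos-* y N)) ⟩
  1ℤ - + y * + N         ≡⟨ rearrange (+ y) (+ N) ⟩
  1ℤ + + N * (- + y)     ≈⟨ +-multiple-mod 1ℤ (- + y) ⟩
  1ℤ                     ∎)
  where
  open ≡-mod-Reasoning N
  negate : ∀ x a → (- x) * a ≡ 1ℤ - (1ℤ + x * a)
  negate = solve-∀
  rearrange : ∀ y N → 1ℤ - y * N ≡ 1ℤ + N * (- y)
  rearrange = solve-∀

prime∤⇒invertible : ∀ {p u} → Prime p → ¬ (+ p ∣ u) → ∃ λ ρ → ρ * u ≡ 1ℤ mod p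
prime∤⇒invertible {p} {u} p-prime p∤u
  with coprime⇒invertible (prime∤⇒coprime p-prime p∤u) | +∣i∣≡i⊎+∣i∣≡-i u
... | α , α∣u∣≡1 | inj₁ +∣u∣≡u = α , subst (λ z → α * z ≡ 1ℤ mod p) +∣u∣≡u α∣u∣≡1
... | α , α∣u∣≡1 | inj₂ +∣u∣≡-u =
  - α , subst (_≡ 1ℤ mod p) (neg-swap α u) (subst (λ z → α * z ≡ 1ℤ mod p) +∣u∣≡-u α∣u∣≡1)
  where
  neg-swap : ∀ α u → α * (- u) ≡ (- α) * u
  neg-swap = solve-∀

chinese-remainder : ∀ {p q} → Coprime p q → ∀ r s → ∃ λ w → w ≡ r mod p × w ≡ s mod q
chinese-remainder {p} {q} p⊥q r s with coprime⇒invertible p⊥q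
... | α , αp≡1 = r + + p * (α * (s - r)) , +-multiple-mod r (α * (s - r)) , (begin
  r + + p * (α * (s - r))  ≡⟨ reassociate r s α (+ p) ⟩
  r + (s - r) * (α * + p)  ≈⟨ +-congˡ-mod r (*-congˡ-mod (s - r) αp≡1) ⟩
  r + (s - r) * 1ℤ         ≡⟨ cancel r s ⟩
  s                        ∎)
  where
  open ≡-mod-Reasoning q
  reassociate : ∀ r s α p → r + p * (α * (s - r)) ≡ r + (s - r) * (α * p)
  reassociate = solve-∀
  cancel : ∀ r s → r + (s - r) * 1ℤ ≡ s
  cancel = solve-∀

-- No-three-in-line sets for an arbitrary collinearity relation; NoThreeInLine m n and IsTau m n are
-- NoThree (Collinear m n) and IsMaxNoThree (Collinear m n) unfolded.

module _ {A : Set} where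

  NoThree : (A → A → A → Set) → List A → Set
  NoThree Col S = ∀ P Q R → P ∈ S → Q ∈ S → R ∈ S → P ≢ Q → Q ≢ R → P ≢ R → ¬ Col P Q R

  NoThreeAttains : (A → A → A → Set) → ℕ → Set
  NoThreeAttains Col t = ∃ λ (S : List A) → Unique S × NoThree Col S × length S ≡ t

  NoThreeBounded : (A → A → A → Set) → ℕ → Set
  NoThreeBounded Col t = ∀ (S : List A) → Unique S → NoThree Col S → length S ≤ t

  IsMaxNoThree : (A → A → A → Set) → ℕ → Set
  IsMaxNoThree Col t = NoThreeAttains Col t × NoThreeBounded Col t

  private
    ≢-outside : ∀ {x y z R : A} → x ≢ y → x ≢ z → R ≡ y ⊎ R ≡ z → R ≢ x
    ≢-outside x≢y _ (inj₁ refl) = λ y≡x → x≢y (sym y≡x)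
    ≢-outside _ x≢z (inj₂ refl) = λ z≡x → x≢z (sym z≡x)

  module _ (_≟_ : DecidableEquality A) where

    private
      avoid-one : ∀ {x y} → x ≢ y → ∀ P → ∃ λ R → (R ≡ x ⊎ R ≡ y) × R ≢ P
      avoid-one {x} {y} x≢y P with x ≟ P
      ... | no x≢P = x , inj₁ refl , x≢P
      ... | yes refl = y , inj₂ refl , λ y≡x → x≢y (sym y≡x)

      avoid-two : ∀ {x y z} → x ≢ y → x ≢ z → y ≢ z → ∀ P Q →
        ∃ λ R → (R ≡ x ⊎ R ≡ y ⊎ R ≡ z) × R ≢ P × R ≢ Q
      avoid-two {x} x≢y x≢z y≢z P Q with x ≟ P | x ≟ Q
      ... | no x≢P | no x≢Q = x , inj₁ refl , x≢P , x≢Q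
      ... | yes refl | _ =
        let R , R∈yz , R≢Q = avoid-one y≢z Q in R , inj₂ R∈yz , ≢-outside x≢y x≢z R∈yz , R≢Q
      ... | no _ | yes refl =
        let R , R∈yz , R≢P = avoid-one y≢z P in R , inj₂ R∈yz , R≢P , ≢-outside x≢y x≢z R∈yz

    third-point : ∀ {S} → Unique S → 3 ≤ length S → ∀ P Q → ∃ λ R → R ∈ S × R ≢ P × R ≢ Q
    third-point {[]} _ ()
    third-point {_ ∷ []} _ (s≤s ())
    third-point {_ ∷ _ ∷ []} _ (s≤s (s≤s ()))
    third-point {x ∷ y ∷ z ∷ _} ((x≢y ∷ x≢z ∷ _) ∷ (y≢z ∷ _) ∷ _) _ P Q =
      let R , R∈xyz , R≢P , R≢Q = avoid-two x≢y x≢z y≢z P Q in R , member R∈xyz , R≢P , R≢Q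
      where
      member : ∀ {R} → R ≡ x ⊎ R ≡ y ⊎ R ≡ z → R ∈ x ∷ y ∷ z ∷ _
      member (inj₁ refl) = here refl
      member (inj₂ (inj₁ refl)) = there (here refl)
      member (inj₂ (inj₂ refl)) = there (there (here refl))

    NoThree-injective : ∀ {C : Set} {Col : A → A → A → Set} (g : A → C) →
      (∀ {P Q} R → g P ≡ g Q → Col P Q R) → ∀ {S} → Unique S → NoThree Col S → 3 ≤ length S →
      ∀ {P Q} → P ∈ S → Q ∈ S → g P ≡ g Q → P ≡ Q
    NoThree-injective g collapse S! no-three 3≤|S| {P} {Q} P∈S Q∈S gP≡gQ with P ≟ Q
    ... | yes P≡Q = P≡Q
    ... | no P≢Q =
      let R , R∈S , R≢P , R≢Q = third-point S! 3≤|S| P Q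
      in contradiction (collapse R gP≡gQ)
           (no-three P Q R P∈S Q∈S R∈S P≢Q (λ Q≡R → R≢Q (sym Q≡R)) (λ P≡R → R≢P (sym P≡R)))

Unique-map⁺-on : ∀ {A B : Set} (f : A → B) {xs} → (∀ {x y} → x ∈ xs → y ∈ xs → f x ≡ f y → x ≡ y) →
  Unique xs → Unique (map f xs)
Unique-map⁺-on f {[]} _ [] = []
Unique-map⁺-on f {x ∷ xs} injective (x∉xs ∷ xs!) =
  All.map⁺ (All.tabulate λ y∈xs fx≡fy → All.lookup x∉xs y∈xs (injective (here refl) (there y∈xs) fx≡fy))
  ∷ Unique-map⁺-on f (λ x∈ y∈ → injective (there x∈) (there y∈)) xs!

NoThree-map : ∀ {A B : Set} {ColA : A → A → A → Set} {ColB : B → B → B → Set} (f : A → B) →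
  (∀ {P Q R} → ColB (f P) (f Q) (f R) → ColA P Q R) → ∀ {S} → NoThree ColA S → NoThree ColB (map f S)
NoThree-map f reflects no-three P′ Q′ R′ P′∈ Q′∈ R′∈ P′≢Q′ Q′≢R′ P′≢R′ col
  with ∈-map⁻ f P′∈ | ∈-map⁻ f Q′∈ | ∈-map⁻ f R′∈
... | P , P∈ , refl | Q , Q∈ , refl | R , R∈ , refl =
  no-three P Q R P∈ Q∈ R∈ (λ e → P′≢Q′ (cong f e)) (λ e → Q′≢R′ (cong f e)) (λ e → P′≢R′ (cong f e))
    (reflects col)

module _ {A B : Set} {ColA : A → A → A → Set} {ColB : B → B → B → Set} (_≟_ : DecidableEquality B)
  (ι : A → B) (ι-injective : ∀ {P Q} → ι P ≡ ι Q → P ≡ Q)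
  (ι-reflects : ∀ {P Q R} → ColB (ι P) (ι Q) (ι R) → ColA P Q R)
  (π : B → A) (π-reflects : ∀ {P Q R} → ColA (π P) (π Q) (π R) → ColB P Q R)
  (π-collapse : ∀ {P Q} R → π P ≡ π Q → ColB P Q R)
  (three : NoThreeAttains ColA 3) where

  private
    ι-image : ∀ {S} → Unique S → NoThree ColA S → NoThreeAttains ColB (length S)
    ι-image {S} S! no-three =
      map ι S , Unique.map⁺ ι-injective S! , NoThree-map ι ι-reflects no-three , length-map ι S

    π-image : ∀ {S} → Unique S → NoThree ColB S → 3 ≤ length S → NoThreeAttains ColA (length S)
    π-image {S} S! no-three 3≤|S| =
      map π S , Unique-map⁺-on π (NoThree-injective _≟_ π π-collapse S! no-three 3≤|S|) S! ,
      NoThree-map π π-reflects no-three , length-map π S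

    ι-bounded : ∀ {t} → NoThreeBounded ColB t → NoThreeBounded ColA t
    ι-bounded bound S S! no-three =
      let S′ , S′! , no-three′ , |S′|≡|S| = ι-image S! no-three
      in subst (_≤ _) |S′|≡|S| (bound S′ S′! no-three′)

    three≤ : ∀ {t} → NoThreeBounded ColA t → 3 ≤ t
    three≤ bound = let S , S! , no-three , |S|≡3 = three in subst (_≤ _) |S|≡3 (bound S S! no-three)

    π-bounded : ∀ {t} → NoThreeBounded ColA t → NoThreeBounded ColB t
    π-bounded bound S S! no-three with 3 ℕ.≤? length S
    ... | yes 3≤|S| =
      let S′ , S′! , no-three′ , |S′|≡|S| = π-image S! no-three 3≤|S|
      in subst (_≤ _) |S′|≡|S| (bound S′ S′! no-three′)
    ... | no 3≰|S| = ℕ.<⇒≤ (ℕ.<-≤-trans (ℕ.≰⇒> 3≰|S|) (three≤ bound))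

  IsMaxNoThree-transfer : ∀ t → IsMaxNoThree ColB t ⇔ IsMaxNoThree ColA t
  IsMaxNoThree-transfer t = mk⇔ to from
    where
    to : IsMaxNoThree ColB t → IsMaxNoThree ColA t
    to ((S , S! , no-three , refl) , bound) =
      π-image S! no-three (three≤ (ι-bounded bound)) , ι-bounded bound

    from : IsMaxNoThree ColA t → IsMaxNoThree ColB t
    from ((S , S! , no-three , refl) , bound) = ι-image S! no-three , π-bounded bound

-- Lines of ℤ² modulo a pair of moduli

record OnLineℤ (M N : ℕ) (a b u v : ℤ) (X : ℤ × ℤ) : Set where
  constructor at
  field
    parameter : ℤ
    first     : a + u * parameter ≡ proj₁ X mod M
    second    : b + v * parameter ≡ proj₂ X mod N

OnLineℤ-swap : ∀ {M N a b u v X Y} → OnLineℤ M N a b u v (X , Y) → OnLineℤ N M b a v u (Y , X)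
OnLineℤ-swap (at k a+uk≡X b+vk≡Y) = at k b+vk≡Y a+uk≡X

OnLineℤ-divisor : ∀ {M N M′ N′ a b u v} → M′ ℕ.∣ M → N′ ℕ.∣ N → ∀ {X} →
  OnLineℤ M N a b u v X → OnLineℤ M′ N′ a b u v X
OnLineℤ-divisor M′∣M N′∣N (at k a+uk≡X b+vk≡Y) =
  at k (mod-divisor M′∣M a+uk≡X) (mod-divisor N′∣N b+vk≡Y)

OnLineℤ-resp : ∀ {M N a b u v X Y X′ Y′} → X ≡ X′ mod M → Y ≡ Y′ mod N →
  OnLineℤ M N a b u v (X , Y) → OnLineℤ M N a b u v (X′ , Y′)
OnLineℤ-resp X≡X′ Y≡Y′ (at k a+uk≡X b+vk≡Y) = at k (mod-trans a+uk≡X X≡X′) (mod-trans b+vk≡Y Y≡Y′)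

OnLineℤ-degenerate : ∀ {N a b u v} → + N ∣ u → + N ∣ v → ∀ {X} →
  OnLineℤ N N a b u v X → OnLineℤ N N a b 1ℤ 0ℤ X
OnLineℤ-degenerate {a = a} {b} {u} {v} N∣u N∣v (at k a+uk≡X b+vk≡Y) =
  at 0ℤ (mod-trans (+-congˡ-mod a (mod-sym (*-congʳ-mod k (∣⇒≡0-mod {a = u} N∣u)))) a+uk≡X)
        (mod-trans (+-congˡ-mod b (mod-sym (*-congʳ-mod k (∣⇒≡0-mod {a = v} N∣v)))) b+vk≡Y)

module _ {M N : ℕ} where
  private
    start : ∀ a u → a + u * 0ℤ ≡ a
    start = solve-∀
    end : ∀ a X → a + (X - a) * 1ℤ ≡ X
    end = solve-∀

  OnLineℤ-start : ∀ a b X Y → OnLineℤ M N a b (X - a) (Y - b) (a , b)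
  OnLineℤ-start a b X Y = at 0ℤ (mod-reflexive (start a (X - a))) (mod-reflexive (start b (Y - b)))

  OnLineℤ-end : ∀ a b X Y → OnLineℤ M N a b (X - a) (Y - b) (X , Y)
  OnLineℤ-end a b X Y = at 1ℤ (mod-reflexive (end a X)) (mod-reflexive (end b Y))

module _ {p m q : ℕ} (p∣m : p ℕ.∣ m) (m⊥q : Coprime m q) where

  private
    p⊥q : Coprime p q
    p⊥q (d∣p , d∣q) = m⊥q (ℕ.∣-trans d∣p p∣m , d∣q)

    reassociate : ∀ v ρ u k → v * ρ * (u * k) ≡ v * k * (ρ * u)
    reassociate = solve-∀

  onto-unit-line : ∀ {a b u v ρ w} → ρ * u ≡ 1ℤ mod p → w ≡ v * ρ mod p → w ≡ 1ℤ mod q →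
    ∀ {X} → OnLineℤ p p a b u v X → OnLineℤ m (p ℕ.* q) a b 1ℤ w X
  onto-unit-line {a} {b} {u} {v} {ρ} {w} ρu≡1 w≡vρ w≡1 {X , Y} (at k a+uk≡X b+vk≡Y) =
    at-solution (chinese-remainder m⊥q (X - a) (Y - b))
    where
    at-solution : (∃ λ K → K ≡ X - a mod m × K ≡ Y - b mod q) → OnLineℤ m (p ℕ.* q) a b 1ℤ w (X , Y)
    at-solution (K , K≡X-a , K≡Y-b) =
      at K (+-moveˡ-mod (mod-trans (mod-reflexive (*-identityˡ K)) K≡X-a))
           (+-moveˡ-mod (mod-chinese p⊥q wK≡Y-b-mod-p wK≡Y-b-mod-q))
      where
      wK≡Y-b-mod-p : w * K ≡ Y - b mod p
      wK≡Y-b-mod-p = begin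
        w * K            ≈⟨ *-cong-mod w≡vρ (mod-trans (mod-divisor p∣m K≡X-a) (mod-sym (+-moveʳ-mod a+uk≡X))) ⟩
        v * ρ * (u * k)  ≡⟨ reassociate v ρ u k ⟩
        v * k * (ρ * u)  ≈⟨ *-congˡ-mod (v * k) ρu≡1 ⟩
        v * k * 1ℤ       ≡⟨ *-identityʳ (v * k) ⟩
        v * k            ≈⟨ +-moveʳ-mod b+vk≡Y ⟩
        Y - b            ∎
        where open ≡-mod-Reasoning p

      wK≡Y-b-mod-q : w * K ≡ Y - b mod q
      wK≡Y-b-mod-q = mod-trans (*-cong-mod w≡1 K≡Y-b) (mod-reflexive (*-identityˡ (Y - b)))

  straighten : ∀ {a b u v ρ} → ρ * u ≡ 1ℤ mod p →
    ∃ λ w → ∀ {X} → OnLineℤ p p a b u v X → OnLineℤ m (p ℕ.* q) a b 1ℤ w X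
  straighten {a} {b} {u} {v} {ρ} ρu≡1 =
    let w , w≡vρ , w≡1 = chinese-remainder p⊥q (v * ρ) 1ℤ
    in w , onto-unit-line {a} {b} {u} {v} ρu≡1 w≡vρ w≡1

embed : ∀ {M N} → Torus M N → ℤ × ℤ
embed (x , y) = + toℕ x , + toℕ y

OnLine⇒OnLineℤ : ∀ {M N a b u v} (P : Torus M N) → OnLine M N a b u v P → OnLineℤ M N a b u v (embed P)
OnLine⇒OnLineℤ _ (k , M∣ , N∣) = at k (congruent M∣) (congruent N∣)

OnLineℤ⇒OnLine : ∀ {M N a b u v} (P : Torus M N) → OnLineℤ M N a b u v (embed P) → OnLine M N a b u v P
OnLineℤ⇒OnLine _ (at k (congruent M∣) (congruent N∣)) = k , M∣ , N∣

det : ℤ × ℤ → ℤ × ℤ → ℤ × ℤ → ℤ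
det (X₁ , Y₁) (X₂ , Y₂) (X₃ , Y₃) = (X₂ - X₁) * (Y₃ - Y₁) - (X₃ - X₁) * (Y₂ - Y₁)

module _ {N : ℕ} where
  private
    det-line : ∀ a b u v k₁ k₂ k₃ →
      ((a + u * k₂) - (a + u * k₁)) * ((b + v * k₃) - (b + v * k₁))
        - ((a + u * k₃) - (a + u * k₁)) * ((b + v * k₂) - (b + v * k₁)) ≡ 0ℤ
    det-line = solve-∀

  det-cong-mod : ∀ {X₁ Y₁ X₂ Y₂ X₃ Y₃ X₁′ Y₁′ X₂′ Y₂′ X₃′ Y₃′} →
    X₁ ≡ X₁′ mod N → Y₁ ≡ Y₁′ mod N → X₂ ≡ X₂′ mod N → Y₂ ≡ Y₂′ mod N →
    X₃ ≡ X₃′ mod N → Y₃ ≡ Y₃′ mod N →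
    det (X₁ , Y₁) (X₂ , Y₂) (X₃ , Y₃) ≡ det (X₁′ , Y₁′) (X₂′ , Y₂′) (X₃′ , Y₃′) mod N
  det-cong-mod x₁ y₁ x₂ y₂ x₃ y₃ =
    -cong-mod (*-cong-mod (-cong-mod x₂ x₁) (-cong-mod y₃ y₁))
              (*-cong-mod (-cong-mod x₃ x₁) (-cong-mod y₂ y₁))

  det-on-line : ∀ {a b u v A B C} → OnLineℤ N N a b u v A → OnLineℤ N N a b u v B → OnLineℤ N N a b u v C →
    det A B C ≡ 0ℤ mod N
  det-on-line {a} {b} {u} {v} (at k₁ x₁ y₁) (at k₂ x₂ y₂) (at k₃ x₃ y₃) =
    mod-trans (mod-sym (det-cong-mod x₁ y₁ x₂ y₂ x₃ y₃)) (mod-reflexive (det-line a b u v k₁ k₂ k₃))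

corner : ∀ q → List (Torus (2 ℕ.+ q) (2 ℕ.+ q))
corner q = (zero , zero) ∷ (suc zero , zero) ∷ (zero , suc zero) ∷ []

private
  pattern ₀ = here refl
  pattern ₁ = there (here refl)
  pattern ₂ = there (there (here refl))

  2+∤1 : ∀ q → ¬ (2 ℕ.+ q ℕ.∣ 1)
  2+∤1 q 2+q∣1 with ℕ.∣1⇒≡1 2+q∣1
  ... | ()

-- For three distinct corner points the determinant is ±1.
corner-det≡0 : ∀ {q P Q R} → P ∈ corner q → Q ∈ corner q → R ∈ corner q →
  det (embed P) (embed Q) (embed R) ≡ 0ℤ mod 2 ℕ.+ q → P ≡ Q ⊎ Q ≡ R ⊎ P ≡ R
corner-det≡0 ₀ ₀ _ _ = inj₁ refl
corner-det≡0 ₁ ₁ _ _ = inj₁ refl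
corner-det≡0 ₂ ₂ _ _ = inj₁ refl
corner-det≡0 _ ₀ ₀ _ = inj₂ (inj₁ refl)
corner-det≡0 _ ₁ ₁ _ = inj₂ (inj₁ refl)
corner-det≡0 _ ₂ ₂ _ = inj₂ (inj₁ refl)
corner-det≡0 ₀ _ ₀ _ = inj₂ (inj₂ refl)
corner-det≡0 ₁ _ ₁ _ = inj₂ (inj₂ refl)
corner-det≡0 ₂ _ ₂ _ = inj₂ (inj₂ refl)
corner-det≡0 {q} ₀ ₁ ₂ (congruent d) = ⊥-elim (2+∤1 q d)
corner-det≡0 {q} ₀ ₂ ₁ (congruent d) = ⊥-elim (2+∤1 q d)
corner-det≡0 {q} ₁ ₀ ₂ (congruent d) = ⊥-elim (2+∤1 q d)
corner-det≡0 {q} ₁ ₂ ₀ (congruent d) = ⊥-elim (2+∤1 q d)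
corner-det≡0 {q} ₂ ₀ ₁ (congruent d) = ⊥-elim (2+∤1 q d)
corner-det≡0 {q} ₂ ₁ ₀ (congruent d) = ⊥-elim (2+∤1 q d)

corner-no-three : ∀ q → NoThree (Collinear (2 ℕ.+ q) (2 ℕ.+ q)) (corner q)
corner-no-three q P Q R P∈ Q∈ R∈ P≢Q Q≢R P≢R (a , b , u , v , _ , hP , hQ , hR) =
  [ P≢Q , [ Q≢R , P≢R ] ] (corner-det≡0 P∈ Q∈ R∈ (det-on-line (on P hP) (on Q hQ) (on R hR)))
  where
  on : ∀ P → OnLine _ _ a b u v P → OnLineℤ _ _ a b u v (embed P)
  on = OnLine⇒OnLineℤ

three-in-general-position : ∀ {N} → 1 < N → NoThreeAttains (Collinear N N) 3
three-in-general-position {1} (s≤s ())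
three-in-general-position {suc (suc q)} _ =
  corner q , ((λ ()) ∷ (λ ()) ∷ []) ∷ ((λ ()) ∷ []) ∷ [] ∷ [] , corner-no-three q , refl

-- Reduction modulo p

module Reduction {p m₁ n₁ : ℕ} .{{_ : NonZero m₁}} .{{_ : NonZero n₁}} (p-prime : Prime p)
  (m⊥n₁ : Coprime (p ℕ.* m₁) n₁) (n⊥m₁ : Coprime (p ℕ.* n₁) m₁) where

  private
    m n : ℕ
    m = p ℕ.* m₁
    n = p ℕ.* n₁

    instance
      p-nonZero : NonZero p
      p-nonZero = prime⇒nonZero p-prime

  LineLift : ℤ → ℤ → ℤ → ℤ → Set
  LineLift a b u v = Σ ℤ λ a′ → Σ ℤ λ b′ → Σ ℤ λ u′ → Σ ℤ λ v′ → ℤ.gcd u′ v′ ≡ + 1 ×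
    (∀ P → OnLineℤ p p a b u v (embed P) → OnLine m n a′ b′ u′ v′ P)

  private
    lift-first : ∀ {a b u v} → (∃ λ ρ → ρ * u ≡ 1ℤ mod p) → LineLift a b u v
    lift-first {a} {b} {u} {v} (ρ , ρu≡1) =
      let w , onto = straighten (ℕ.m∣m*n m₁) m⊥n₁ {a} {b} {u} {v} {ρ} ρu≡1
      in a , b , 1ℤ , w , gcd-zeroˡ w , λ P h → OnLineℤ⇒OnLine P (onto h)

    lift-second : ∀ {a b u v} → (∃ λ ρ → ρ * v ≡ 1ℤ mod p) → LineLift a b u v
    lift-second {a} {b} {u} {v} (ρ , ρv≡1) =
      let w , onto = straighten (ℕ.m∣m*n n₁) n⊥m₁ {b} {a} {v} {u} {ρ} ρv≡1
      in a , b , w , 1ℤ , gcd-zeroʳ w , λ P h → OnLineℤ⇒OnLine P (OnLineℤ-swap (onto (OnLineℤ-swap h)))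

  lift-line : ∀ a b u v → LineLift a b u v
  lift-line a b u v with p ℕ.∣? ∣ u ∣ | p ℕ.∣? ∣ v ∣
  ... | no p∤u | _ = lift-first (prime∤⇒invertible p-prime p∤u)
  ... | yes _ | no p∤v = lift-second (prime∤⇒invertible p-prime p∤v)
  ... | yes p∣u | yes p∣v =
    let a′ , b′ , u′ , v′ , gcd≡1 , on = lift-first {a} {b} {1ℤ} {0ℤ} (1ℤ , mod-refl)
    in a′ , b′ , u′ , v′ , gcd≡1 , λ P h → on P (OnLineℤ-degenerate p∣u p∣v h)

  collinear-of-mod-line : ∀ {a b u v} P Q R →
    OnLineℤ p p a b u v (embed P) → OnLineℤ p p a b u v (embed Q) → OnLineℤ p p a b u v (embed R) →
    Collinear m n P Q R
  collinear-of-mod-line {a} {b} {u} {v} P Q R hP hQ hR =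
    let a′ , b′ , u′ , v′ , gcd≡1 , on = lift-line a b u v
    in a′ , b′ , u′ , v′ , gcd≡1 , on P hP , on Q hQ , on R hR

  reduceFin : ∀ {M} → Fin M → Fin p
  reduceFin x = fromℕ< (m%n<n (toℕ x) p)

  reduceFin-≡-mod : ∀ {M} (x : Fin M) → + toℕ (reduceFin x) ≡ + toℕ x mod p
  reduceFin-≡-mod x rewrite toℕ-fromℕ< (m%n<n (toℕ x) p) = %-≡-mod (toℕ x) p

  reduceFin-≡⇒≡-mod : ∀ {M} {x x′ : Fin M} → reduceFin x ≡ reduceFin x′ → + toℕ x ≡ + toℕ x′ mod p
  reduceFin-≡⇒≡-mod {x = x} {x′} eq =
    mod-trans (mod-sym (reduceFin-≡-mod x))
              (subst (λ r → + toℕ r ≡ + toℕ x′ mod p) (sym eq) (reduceFin-≡-mod x′))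

  reduce : Torus m n → Torus p p
  reduce (x , y) = reduceFin x , reduceFin y

  reduce-reflects-collinear : ∀ {P Q R} → Collinear p p (reduce P) (reduce Q) (reduce R) → Collinear m n P Q R
  reduce-reflects-collinear {P} {Q} {R} (a , b , u , v , _ , hP , hQ , hR) =
    collinear-of-mod-line P Q R (unreduce P hP) (unreduce Q hQ) (unreduce R hR)
    where
    unreduce : ∀ P → OnLine p p a b u v (reduce P) → OnLineℤ p p a b u v (embed P)
    unreduce P@(x , y) h = OnLineℤ-resp (reduceFin-≡-mod x) (reduceFin-≡-mod y) (OnLine⇒OnLineℤ (reduce P) h)

  reduce-collapse⇒collinear : ∀ {P Q} R → reduce P ≡ reduce Q → Collinear m n P Q R
  reduce-collapse⇒collinear {P@(x , y)} {Q} R@(x″ , y″) eq =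
    collinear-of-mod-line P Q R
      P-on-PR
      (OnLineℤ-resp (reduceFin-≡⇒≡-mod (cong proj₁ eq)) (reduceFin-≡⇒≡-mod (cong proj₂ eq)) P-on-PR)
      (OnLineℤ-end (+ toℕ x) (+ toℕ y) (+ toℕ x″) (+ toℕ y″))
    where
    P-on-PR = OnLineℤ-start (+ toℕ x) (+ toℕ y) (+ toℕ x″) (+ toℕ y″)

  include : Torus p p → Torus m n
  include (x , y) = inject≤ x (ℕ.m≤m*n p m₁) , inject≤ y (ℕ.m≤m*n p n₁)

  include-injective : ∀ {P Q} → include P ≡ include Q → P ≡ Q
  include-injective {x , y} {x′ , y′} eq =
    cong₂ _,_ (inject≤-injective _ _ x x′ (cong proj₁ eq)) (inject≤-injective _ _ y y′ (cong proj₂ eq))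

  embed-include : ∀ P → embed (include P) ≡ embed P
  embed-include (x , y) = cong₂ _,_ (cong +_ (toℕ-inject≤ x _)) (cong +_ (toℕ-inject≤ y _))

  include-reflects-collinear : ∀ {P Q R} → Collinear m n (include P) (include Q) (include R) → Collinear p p P Q R
  include-reflects-collinear {P} {Q} {R} (a , b , u , v , gcd≡1 , hP , hQ , hR) =
    a , b , u , v , gcd≡1 , restrict P hP , restrict Q hQ , restrict R hR
    where
    restrict : ∀ P → OnLine m n a b u v (include P) → OnLine p p a b u v P
    restrict P h = OnLineℤ⇒OnLine P (OnLineℤ-divisor (ℕ.m∣m*n m₁) (ℕ.m∣m*n n₁)
      (subst (OnLineℤ m n a b u v) (embed-include P) (OnLine⇒OnLineℤ (include P) h)))

  tau-reduction : ∀ t → IsTau m n t ⇔ IsTau p p t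
  tau-reduction = IsMaxNoThree-transfer (≡-dec _≟ᶠ_ _≟ᶠ_)
    include include-injective include-reflects-collinear
    reduce reduce-reflects-collinear reduce-collapse⇒collinear
    (three-in-general-position (nonTrivial⇒n>1 p {{prime⇒nonTrivial p-prime}}))

tau-of-common-prime : ∀ {m n p} → Prime p → 1 < m → 1 < n → p ℕ.∣ m → p ℕ.∣ n →
  gcd (p ℕ.* m) n ≡ p → gcd m (p ℕ.* n) ≡ p → ∀ t → IsTau m n t ⇔ IsTau p p t
tau-of-common-prime _ () _ (ℕ.divides 0 refl) _ _ _
tau-of-common-prime _ _ () _ (ℕ.divides 0 refl) _ _
tau-of-common-prime {m} {n} {p} p-prime _ _ (ℕ.divides m₁@(suc _) m≡m₁p) (ℕ.divides n₁@(suc _) n≡n₁p)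
  gcd[pm,n]≡p gcd[m,pn]≡p t =
  subst₂ (λ M N → IsTau M N t ⇔ IsTau p p t) (sym m≡pm₁) (sym n≡pn₁)
    (Reduction.tau-reduction p-prime m⊥n₁ n⊥m₁ t)
  where
  instance _ = prime⇒nonZero p-prime
  m≡pm₁ = trans m≡m₁p (ℕ.*-comm m₁ p)
  n≡pn₁ = trans n≡n₁p (ℕ.*-comm n₁ p)
  m⊥n₁ : Coprime (p ℕ.* m₁) n₁
  m⊥n₁ = subst (λ M → Coprime M n₁) m≡pm₁
    (gcd[cm,cn]≡c⇒coprime p m n₁ (subst (λ N → gcd (p ℕ.* m) N ≡ p) n≡pn₁ gcd[pm,n]≡p))
  n⊥m₁ : Coprime (p ℕ.* n₁) m₁
  n⊥m₁ = subst (λ N → Coprime N m₁) n≡pn₁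
    (Coprimality.sym (gcd[cm,cn]≡c⇒coprime p m₁ n (subst (λ M → gcd M (p ℕ.* n) ≡ p) m≡pm₁ gcd[m,pn]≡p)))

theorem4p5 : (m n : ℕ) → 1 < m → 1 < n →
    Prime (gcd m n) → ¬ (2 ℕ.∣ gcd m n) →
    gcd (gcd m n ℕ.* m) n ≡ gcd m n → gcd m (gcd m n ℕ.* n) ≡ gcd m n →
    (t : ℕ) → IsTau m n t ⇔ IsTau (gcd m n) (gcd m n) t
theorem4p5 m n 1<m 1<n p-prime _ =
  tau-of-common-prime p-prime 1<m 1<n (gcd[m,n]∣m m n) (gcd[m,n]∣n m n)
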